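{- Let $G$ be a $\lambda$-graph, let $B$ be a bisimulation over the nodes of $G$, and let $Q$ be a query over $G$ with $Q\subseteq B$. Then the propagation $Q^{\Downarrow}$ is a bisimulation.
   Context: A $\lambda$-graph is a finite directed graph with application nodes $\mathrm{App}(n_1,n_2)$ (left child $n_1$, direction $\swarrow$; right child $n_2$, direction $\searrow$), abstraction nodes $\mathrm{Abs}(n)$ (child $n$, direction $\downarrow$), free variable nodes (no children) and bound variable nodes $\mathrm{Var}(l)$ with a binding edge to an abstraction node $l$ (its binder). Paths follow only child edges (not binding edges). A root is a node with no path of nonempty trace ending at it. The graph is acyclic (ignoring binding edges) and dominated: every path from a root to a bound variable node $\mathrm{Var}(l)$ passes through $l$. Nodes are homogeneous if of the same kind. A bisimulation is a relation $R$ relating only homogeneous nodes and closed under: $\mathrm{App}(n_1,n_2)\,R\,\mathrm{App}(m_1,m_2)\Rightarrow n_1Rm_1$ and $n_2Rm_2$; $\mathrm{Abs}(n)\,R\,\mathrm{Abs}(m)\Rightarrow nRm$; $\mathrm{Var}(n)\,R\,\mathrm{Var}(m)\Rightarrow nRm$. A query is a binary relation on the roots of $G$. The propagation $Q^{\Downarrow}$ is the smallest relation containing $Q$ closed under the $\mathrm{App}$ and $\mathrm{Abs}$ rules above. -}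

module Defs where

open import Data.Nat using (ℕ)
open import Data.Fin using (Fin)
open import Data.Product using (Σ; ∃; _×_; _,_)
open import Data.Empty using (⊥)
open import Relation.Nullary using (¬_)
open import Relation.Binary.PropositionalEquality using (_≡_)

data Node (n : ℕ) : Set where
  app  : Fin n → Fin n → Node n
  abs  : Fin n → Node n
  fvar : Node n
  var  : Fin n → Node n           -- Var(binder): binding edge, NOT a child edge

data Kind : Set where
  kApp kAbs kFVar kVar : Kind

kind : ∀ {n} → Node n → Kind
kind (app _ _) = kApp
kind (abs _)   = kAbs
kind fvar      = kFVar
kind (var _)   = kVar

record PreGraph : Set where
  field
    size  : ℕ
    label : Fin size → Node size

module _ (G : PreGraph) where
  open PreGraph G

  data Child : Fin size → Fin size → Set where
    left  : ∀ {x a b} → label x ≡ app a b → Child x a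
    right : ∀ {x a b} → label x ≡ app a b → Child x b
    down  : ∀ {x a}   → label x ≡ abs a   → Child x a

  data Path : Fin size → Fin size → Set where
    here : ∀ {x} → Path x x
    step : ∀ {x y z} → Child x y → Path y z → Path x z

  data Path⁺ : Fin size → Fin size → Set where
    step⁺ : ∀ {x y z} → Child x y → Path y z → Path⁺ x z

  data Visits (l : Fin size) : ∀ {x y} → Path x y → Set where
    at    : ∀ {y} (p : Path l y) → Visits l p
    later : ∀ {x y z} (c : Child x y) (p : Path y z) → Visits l p → Visits l (step c p)

  IsRoot : Fin size → Set
  IsRoot x = ∀ y → ¬ Path⁺ y x

  Acyclic : Set
  Acyclic = ∀ x → ¬ Path⁺ x x

  Dominated : Set
  Dominated = ∀ r x l → IsRoot r → label x ≡ var l → (p : Path r x) → Visits l p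

  BindersAbs : Set
  BindersAbs = ∀ x l → label x ≡ var l → ∃ λ a → label l ≡ abs a

  Rel : Set₁
  Rel = Fin size → Fin size → Set

  record IsBisimulation (R : Rel) : Set where
    field
      homogeneous : ∀ {x y} → R x y → kind (label x) ≡ kind (label y)
      app-closed  : ∀ {x y n₁ n₂ m₁ m₂} → R x y → label x ≡ app n₁ n₂ → label y ≡ app m₁ m₂ →
                    R n₁ m₁ × R n₂ m₂
      abs-closed  : ∀ {x y n m} → R x y → label x ≡ abs n → label y ≡ abs m → R n m
      var-closed  : ∀ {x y n m} → R x y → label x ≡ var n → label y ≡ var m → R n m

  IsQuery : Rel → Set
  IsQuery Q = ∀ {x y} → Q x y → IsRoot x × IsRoot y

  data Propagation (Q : Rel) : Rel where
    base : ∀ {x y} → Q x y → Propagation Q x y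
    appˡ : ∀ {x y n₁ n₂ m₁ m₂} → Propagation Q x y → label x ≡ app n₁ n₂ → label y ≡ app m₁ m₂ →
           Propagation Q n₁ m₁
    appʳ : ∀ {x y n₁ n₂ m₁ m₂} → Propagation Q x y → label x ≡ app n₁ n₂ → label y ≡ app m₁ m₂ →
           Propagation Q n₂ m₂
    absᵈ : ∀ {x y n m} → Propagation Q x y → label x ≡ abs n → label y ≡ abs m →
           Propagation Q n m

record IsLambdaGraph (G : PreGraph) : Set where
  field
    acyclic    : Acyclic G
    dominated  : Dominated G
    bindersAbs : BindersAbs G

-- The App, Abs and homogeneity conditions for Q⇓ are immediate: Q⇓ is closed
-- under the App and Abs rules by definition, and Q⇓ ⊆ B because B is closed
-- under the same rules.  The content is the Var condition.  A pair x Q⇓ y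
-- arises from a Q-pair of roots r Q r' by two paths with one common trace t.
-- If x = Var(l) and y = Var(l'), dominance splits t at l and at l' into
-- prefixes t₁ (r ⇝ l) and t₁' (r' ⇝ l').  If t₁ = t₁' then propagating
-- along t₁ gives l Q⇓ l'.  Otherwise one prefix is strictly shorter, say
-- t₁ = t₁' ++ w with w nonempty, and we get u ⇝w l with u B l' and l B l'
-- (by var-closure of B).  Such a configuration can be pumped: matching w
-- through B from l' and then back from l yields l ⇝w l'' with l B v', l'' B v'
-- for some v', and so on forever.  This is an infinite chain of nonempty
-- paths, impossible in a finite acyclic graph (pigeonhole).
module Submission where

open import Defs
open import Data.Nat using (ℕ; zero; suc; _<_)
open import Data.Nat.Properties using (m<1+n⇒m<n∨m≡n; n<1+n)
open import Data.Fin using (Fin; toℕ)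
open import Data.Fin.Properties using (pigeonhole)
open import Data.List using (List; []; _∷_; _++_; [_])
open import Data.List.Properties using (∷-injective)
open import Data.Product using (∃; ∃₂; _×_; _,_; proj₁; proj₂)
open import Data.Sum using (_⊎_; inj₁; inj₂)
open import Data.Empty using (⊥)
open import Relation.Binary.PropositionalEquality using (_≡_; refl; sym; trans; cong; subst)

data Dir : Set where
  ↙ ↘ ↓ : Dir

Trace : Set
Trace = List Dir

module _ (G : PreGraph) where
  open PreGraph G

  data Edge : Dir → Fin size → Fin size → Set where
    ↙ : ∀ {x a b} → label x ≡ app a b → Edge ↙ x a
    ↘ : ∀ {x a b} → label x ≡ app a b → Edge ↘ x b
    ↓ : ∀ {x a}   → label x ≡ abs a   → Edge ↓ x a

  data TPath : Trace → Fin size → Fin size → Set where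
    []  : ∀ {x} → TPath [] x x
    _∷_ : ∀ {d t x y z} → Edge d x y → TPath t y z → TPath (d ∷ t) x z

  edge→child : ∀ {d x y} → Edge d x y → Child G x y
  edge→child (↙ e) = left e
  edge→child (↘ e) = right e
  edge→child (↓ e) = down e

  untrace : ∀ {t x y} → TPath t x y → Path G x y
  untrace []       = here
  untrace (c ∷ p) = step (edge→child c) (untrace p)

  untrace⁺ : ∀ {d t x y} → TPath (d ∷ t) x y → Path⁺ G x y
  untrace⁺ (c ∷ p) = step⁺ (edge→child c) (untrace p)

  snoc : ∀ {t d x y z} → TPath t x y → Edge d y z → TPath (t ++ [ d ]) x z
  snoc []       c = c ∷ []
  snoc (c′ ∷ p) c = c′ ∷ snoc p c

  split : ∀ t₁ {t₂ x z} → TPath (t₁ ++ t₂) x z → ∃ λ y → TPath t₁ x y × TPath t₂ y z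
  split []       p       = _ , [] , p
  split (_ ∷ t₁) (c ∷ p) with y , p₁ , p₂ ← split t₁ p = y , c ∷ p₁ , p₂

  _++ᵖ_ : ∀ {x y z} → Path G x y → Path G y z → Path G x z
  here     ++ᵖ q = q
  step c p ++ᵖ q = step c (p ++ᵖ q)

  trans⁺ : ∀ {x y z} → Path⁺ G x y → Path⁺ G y z → Path⁺ G x z
  trans⁺ (step⁺ c p) (step⁺ c′ q) = step⁺ c (p ++ᵖ step c′ q)

  -- A finite acyclic graph admits no infinite chain of nonempty paths:
  -- two of the first size + 1 nodes coincide, closing a cycle.
  no-infinite-descent : Acyclic G → (f : ℕ → Fin size) →
    (∀ k → Path⁺ G (f k) (f (suc k))) → ⊥
  no-infinite-descent acyclic f next
    with i , j , i<j , fi≡fj ← pigeonhole (n<1+n size) (λ i → f (toℕ i))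
    = acyclic _ (subst (Path⁺ G (f (toℕ i))) (sym fi≡fj) (chain (toℕ i) (toℕ j) i<j))
    where
    chain : ∀ i j → i < j → Path⁺ G (f i) (f j)
    chain i (suc j) i<1+j with m<1+n⇒m<n∨m≡n i<1+j
    ... | inj₁ i<j  = trans⁺ (chain i j i<j) (next j)
    ... | inj₂ refl = next i

  record DownClosed (R : Rel G) : Set where
    field
      app-rule : ∀ {x y n₁ n₂ m₁ m₂} → R x y → label x ≡ app n₁ n₂ → label y ≡ app m₁ m₂ →
                 R n₁ m₁ × R n₂ m₂
      abs-rule : ∀ {x y n m} → R x y → label x ≡ abs n → label y ≡ abs m → R n m

  bisimulation-down-closed : ∀ {B} → IsBisimulation G B → DownClosed B
  bisimulation-down-closed bis = record { app-rule = app-closed ; abs-rule = abs-closed }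
    where open IsBisimulation bis

  propagation-down-closed : ∀ {Q} → DownClosed (Propagation G Q)
  propagation-down-closed = record
    { app-rule = λ r e e′ → appˡ r e e′ , appʳ r e e′ ; abs-rule = absᵈ }

  along : ∀ {R t x y x′ y′} → DownClosed R → R x y → TPath t x x′ → TPath t y y′ → R x′ y′
  along R↓ r []         []          = r
  along R↓ r (↙ e ∷ p) (↙ e′ ∷ q) = along R↓ (proj₁ (DownClosed.app-rule R↓ r e e′)) p q
  along R↓ r (↘ e ∷ p) (↘ e′ ∷ q) = along R↓ (proj₂ (DownClosed.app-rule R↓ r e e′)) p q
  along R↓ r (↓ e ∷ p) (↓ e′ ∷ q) = along R↓ (DownClosed.abs-rule R↓ r e e′) p q

  converse : ∀ {B} → IsBisimulation G B → IsBisimulation G (λ x y → B y x)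
  converse bis = record
    { homogeneous = λ r → sym (homogeneous r)
    ; app-closed  = λ r e e′ → let (r₁ , r₂) = app-closed r e′ e in r₁ , r₂
    ; abs-closed  = λ r e e′ → abs-closed r e′ e
    ; var-closed  = λ r e e′ → var-closed r e′ e }
    where open IsBisimulation bis

  -- homogeneity lets a bisimulation match every edge, hence every path
  module Transfer {B : Rel G} (bis : IsBisimulation G B) where
    open IsBisimulation bis

    app-kind : (nd : Node size) → kApp ≡ kind nd → ∃₂ λ m₁ m₂ → nd ≡ app m₁ m₂
    app-kind (app m₁ m₂) _ = m₁ , m₂ , refl

    abs-kind : (nd : Node size) → kAbs ≡ kind nd → ∃ λ m → nd ≡ abs m
    abs-kind (abs m) _ = m , refl

    same-kind : ∀ {x y} → B x y → ∀ {nd} → label x ≡ nd → kind nd ≡ kind (label y)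
    same-kind r e = trans (sym (cong kind e)) (homogeneous r)

    transfer-edge : ∀ {d x y x′} → B x y → Edge d x x′ → ∃ λ y′ → Edge d y y′ × B x′ y′
    transfer-edge {y = y} r (↙ e) with m₁ , m₂ , e′ ← app-kind (label y) (same-kind r e)
      = m₁ , ↙ e′ , proj₁ (app-closed r e e′)
    transfer-edge {y = y} r (↘ e) with m₁ , m₂ , e′ ← app-kind (label y) (same-kind r e)
      = m₂ , ↘ e′ , proj₂ (app-closed r e e′)
    transfer-edge {y = y} r (↓ e) with m , e′ ← abs-kind (label y) (same-kind r e)
      = m , ↓ e′ , abs-closed r e e′

    transfer : ∀ {t x y x′} → B x y → TPath t x x′ → ∃ λ y′ → TPath t y y′ × B x′ y′
    transfer r []      = _ , [] , r
    transfer r (c ∷ p)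
      with y₁ , c′ , r₁ ← transfer-edge r c
      with y′ , p′ , r′ ← transfer r₁ p
      = y′ , c′ ∷ p′ , r′

  open Transfer using (transfer)

  record Pump (B : Rel G) (w : Trace) : Set where
    constructor pump
    field
      src tgt partner : Fin size
      src~partner : B src partner
      tgt~partner : B tgt partner
      path        : TPath w src tgt

  pump-step : ∀ {B w} → IsBisimulation G B → Pump B w → Pump B w
  pump-step bis (pump u l v u~v l~v p) =
    let (v′ , q , l~v′)   = transfer bis u~v p
        (l′ , p′ , l′~v′) = transfer (converse bis) l~v q
    in pump l l′ v′ l~v′ l′~v′ p′

  no-pumping : ∀ {B d s} → Acyclic G → IsBisimulation G B → Pump B (d ∷ s) → ⊥
  no-pumping {B} {d} {s} acyclic bis start =
    no-infinite-descent acyclic (λ k → Pump.src (iterate k)) (λ k → untrace⁺ (Pump.path (iterate k)))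
    where
    iterate : ℕ → Pump B (d ∷ s)
    iterate zero    = start
    iterate (suc k) = pump-step bis (iterate k)

  split-at-visit : ∀ {l t r x} (p : TPath t r x) → Visits G l (untrace p) →
    ∃₂ λ t₁ t₂ → t ≡ t₁ ++ t₂ × TPath t₁ r l × TPath t₂ l x
  split-at-visit []      (at _)        = [] , _ , refl , [] , []
  split-at-visit (c ∷ p) (at _)        = [] , _ , refl , [] , c ∷ p
  split-at-visit (c ∷ p) (later _ _ v) with t₁ , t₂ , refl , p₁ , p₂ ← split-at-visit p v
    = _ ∷ t₁ , t₂ , refl , c ∷ p₁ , p₂

  compare-prefixes : ∀ {A : Set} (t₁ t₂ t₁′ t₂′ : List A) → t₁ ++ t₂ ≡ t₁′ ++ t₂′ →
    t₁ ≡ t₁′ ⊎ (∃₂ λ d s → t₁ ≡ t₁′ ++ d ∷ s) ⊎ (∃₂ λ d s → t₁′ ≡ t₁ ++ d ∷ s)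
  compare-prefixes []       _  []        _   _ = inj₁ refl
  compare-prefixes []       _  (d ∷ s)   _   _ = inj₂ (inj₂ (d , s , refl))
  compare-prefixes (d ∷ s)  _  []        _   _ = inj₂ (inj₁ (d , s , refl))
  compare-prefixes (d ∷ s) t₂ (d′ ∷ s′) t₂′ eq with refl , eq′ ← ∷-injective eq
    with compare-prefixes s t₂ s′ t₂′ eq′
  ... | inj₁ refl                      = inj₁ refl
  ... | inj₂ (inj₁ (d″ , s″ , refl)) = inj₂ (inj₁ (d″ , s″ , refl))
  ... | inj₂ (inj₂ (d″ , s″ , refl)) = inj₂ (inj₂ (d″ , s″ , refl))

  -- B-related nodes l, l' reached from B-related r, r' by comparable traces
  -- are reached at the same depth: otherwise they would form a pumping configuration
  aligned-depths : ∀ {B r r′ l l′ t₁ t₁′} t₂ t₂′ → Acyclic G → IsBisimulation G B →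
    B r r′ → B l l′ → TPath t₁ r l → TPath t₁′ r′ l′ → t₁ ++ t₂ ≡ t₁′ ++ t₂′ → t₁ ≡ t₁′
  aligned-depths {t₁ = t₁} {t₁′} t₂ t₂′ acyclic bis r~r′ l~l′ p p′ eq
    with compare-prefixes t₁ t₂ t₁′ t₂′ eq
  ... | inj₁ t₁≡t₁′ = t₁≡t₁′
  ... | inj₂ (inj₁ (_ , _ , refl))
    with u , r⇝u , u⇝l ← split t₁′ p
    with () ← no-pumping acyclic bis
               (pump u _ _ (along (bisimulation-down-closed bis) r~r′ r⇝u p′) l~l′ u⇝l)
  aligned-depths {t₁ = t₁} t₂ t₂′ acyclic bis r~r′ l~l′ p p′ eq
      | inj₂ (inj₂ (_ , _ , refl))
    with u′ , r′⇝u′ , u′⇝l′ ← split t₁ p′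
    with () ← no-pumping acyclic (converse bis)
               (pump u′ _ _ (along (bisimulation-down-closed bis) r~r′ p r′⇝u′) l~l′ u′⇝l′)

  module _ {Q : Rel G} where
    record Descends (x y : Fin size) : Set where
      constructor descends
      field
        {root root′} : Fin size
        trace        : Trace
        related      : Q root root′
        left-path    : TPath trace root x
        right-path   : TPath trace root′ y

    origin : ∀ {x y} → Propagation G Q x y → Descends x y
    origin (base q) = descends [] q [] []
    origin (appˡ pr e e′) with descends _ q p p′ ← origin pr
      = descends _ q (snoc p (↙ e)) (snoc p′ (↙ e′))
    origin (appʳ pr e e′) with descends _ q p p′ ← origin pr
      = descends _ q (snoc p (↘ e)) (snoc p′ (↘ e′))
    origin (absᵈ pr e e′) with descends _ q p p′ ← origin pr
      = descends _ q (snoc p (↓ e)) (snoc p′ (↓ e′))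

    propagation⊆ : ∀ {B} → IsBisimulation G B → (∀ {x y} → Q x y → B x y) →
      ∀ {x y} → Propagation G Q x y → B x y
    propagation⊆ bis Q⊆B pr with descends _ q p p′ ← origin pr
      = along (bisimulation-down-closed bis) (Q⊆B q) p p′

    propagation-var-closed : ∀ {B} → IsLambdaGraph G → IsBisimulation G B → IsQuery G Q →
      (∀ {x y} → Q x y → B x y) →
      ∀ {x y l l′} → Propagation G Q x y → label x ≡ var l → label y ≡ var l′ →
      Propagation G Q l l′
    propagation-var-closed lg bis isQ Q⊆B pr e e′
      with descends _ q p p′ ← origin pr
      with t₁ , t₂ , t≡t₁t₂ , r⇝l , _ ← split-at-visit p
             (IsLambdaGraph.dominated lg _ _ _ (proj₁ (isQ q)) e (untrace p))
      with t₁′ , t₂′ , t≡t₁′t₂′ , r′⇝l′ , _ ← split-at-visit p′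
             (IsLambdaGraph.dominated lg _ _ _ (proj₂ (isQ q)) e′ (untrace p′))
      with refl ← aligned-depths t₂ t₂′ (IsLambdaGraph.acyclic lg) bis (Q⊆B q)
                    (IsBisimulation.var-closed bis (propagation⊆ bis Q⊆B pr) e e′)
                    r⇝l r′⇝l′ (trans (sym t≡t₁t₂) t≡t₁′t₂′)
      = along propagation-down-closed (base q) r⇝l r′⇝l′

mainTheorem9 : (G : PreGraph) → IsLambdaGraph G →
    (B Q : Rel G) → IsBisimulation G B → IsQuery G Q →
    (∀ {x y} → Q x y → B x y) →
    IsBisimulation G (Propagation G Q)
mainTheorem9 G lg B Q bis isQ Q⊆B = record
  { homogeneous = λ pr → homogeneous (propagation⊆ G bis Q⊆B pr)
  ; app-closed  = app-rule
  ; abs-closed  = abs-rule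
  ; var-closed  = propagation-var-closed G lg bis isQ Q⊆B }
  where
  open IsBisimulation bis using (homogeneous)
  open DownClosed (propagation-down-closed G {Q}) using (app-rule; abs-rule)
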